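{- Let $p$ be a prime, and let $m$ and $n$ be integers with $n \geq 1$ and $n+2 \leq m \leq (p-1)/2$. Let $(\lambda_1, \ldots, \lambda_m)$ be a sequence of integers with $p \geq \lambda_1 \geq \cdots \geq \lambda_m > 0$ and $\sum_{k=1}^m \lambda_k \geq np + 1$. Let $(\mu_1, \ldots, \mu_{2m-1})$ be a sequence of integers such that $\mu_{i+j-1} \geq \min\{\lambda_i + \lambda_j - 1, p\}$ for all $1 \leq i, j \leq m$. Then \[\sum_{k=1}^{2m-1} \mu_k \geq (2n+1)p.\] -}

module Defs where

open import Data.Nat using (ℕ; zero; suc)
open import Data.Integer using (ℤ; _+_; +_)

sumTo : ℕ → (ℕ → ℤ) → ℤ
sumTo zero    f = + 0
sumTo (suc n) f = sumTo n f + f n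

module Submission where

-- Lemma 6.2.  Write m = K + 1 (so K ≥ 2 since m ≥ n + 2 ≥ 3) and index from 0, so that
-- λ₀ is the largest λ, S = Σ_{k<m} λ_k = λ₀ + T with T = λ₁ + ⋯ + λ_K, and the μ-sum of
-- length 2m - 1 = m + K splits into the head μ₀ … μ_K and the tail μ_m … μ_{2K}.
-- Pairing i + 1 with K gives μ_{m+i} ≥ λ_{i+1} (as λ_K ≥ 1 and λ_{i+1} ≤ p), so the tail is
-- at least T.  The head is estimated through the pairs (0, j), according to which of the
-- bounds min(λ₀ + λ_j - 1, p) are capped:
--   (Ia)  λ₀ + λ_{K-1} - 1 ≥ p: μ₀ … μ_{K-1} are all ≥ p and μ_K ≥ λ₀;
--   (Ib)  2λ₀ - 1 ≥ p > λ₀ + λ_{K-1} - 1: μ₀ ≥ p, μ_j ≥ λ_j, and μ_{K-1}, μ_K are uncapped;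
--   (IIa) 2λ₀ - 1 < p (no bound is capped at all) and K(λ₀ - 1) ≥ p - 1: row 0 suffices;
--   (IIb) 2λ₀ - 1 < p and K(λ₀ - 1) < p - 1: the pairs (i, i) and (i, i + 1) give the
--         staircase bound Σμ ≥ 4S - λ₀ - λ_K - (2K + 1), and since p is an odd prime the
--         first row is short, 2(λ₀ + K) ≤ p + 3.
-- Each case ends with a linear computation using S ≥ np + 1.  The file develops finite
-- sums, the arithmetic of odd primes behind (IIb), the staircase bound, the closing linear
-- computations, the bounds that hold under the hypotheses (module Setting), and the theorem.

open import Defs
open import Data.Nat as ℕ using (ℕ; suc)
open import Data.Nat.Primality using (Prime)
open import Data.Integer using (ℤ; +_; _+_; _-_; _*_; _≤_; _<_; _≥_; _⊓_)

open import Data.Nat.Primality using (composite)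
open import Data.Nat.Divisibility using (divides)
open import Data.Nat.DivMod using (_/_; _%_; m≡m%n+[m/n]*n; m%n<n; m*n/n≡m; /-monoˡ-≤)
open import Data.Integer using (-_; ∣_∣; +≤+)
import Data.Nat.Properties as ℕP
import Data.Integer.Properties as ℤP
import Data.Nat.Tactic.RingSolver as ℕSolver
import Data.Integer.Tactic.RingSolver as ℤSolver
open import Relation.Binary.PropositionalEquality using (_≡_; refl; sym; trans; cong; subst; subst₂; module ≡-Reasoning)
open import Relation.Nullary using (¬_; Dec; yes; no)
open import Data.Empty using (⊥-elim)

sum-mono : ∀ n {f g : ℕ → ℤ} → (∀ k → k ℕ.< n → f k ≤ g k) → sumTo n f ≤ sumTo n g
sum-mono ℕ.zero  f≤g = ℤP.≤-refl
sum-mono (suc n) f≤g =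
  ℤP.+-mono-≤ (sum-mono n (λ k k<n → f≤g k (ℕP.m<n⇒m<1+n k<n))) (f≤g n (ℕP.n<1+n n))

sum-shift : ∀ n (f : ℕ → ℤ) → sumTo (suc n) f ≡ f 0 + sumTo n (λ i → f (suc i))
sum-shift ℕ.zero  f = ℤP.+-comm (+ 0) (f 0)
sum-shift (suc n) f = trans (cong (_+ f (suc n)) (sum-shift n f)) (ℤP.+-assoc (f 0) _ _)

sum-split : ∀ a b (f : ℕ → ℤ) → sumTo (a ℕ.+ b) f ≡ sumTo a f + sumTo b (λ i → f (a ℕ.+ i))
sum-split a ℕ.zero f = trans (cong (λ k → sumTo k f) (ℕP.+-identityʳ a)) (sym (ℤP.+-identityʳ _))
sum-split a (suc b) f = begin
  sumTo (a ℕ.+ suc b) f             ≡⟨ cong (λ k → sumTo k f) (ℕP.+-suc a b) ⟩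
  sumTo (a ℕ.+ b) f + g b           ≡⟨ cong (_+ g b) (sum-split a b f) ⟩
  sumTo a f + sumTo b g + g b       ≡⟨ ℤP.+-assoc (sumTo a f) (sumTo b g) (g b) ⟩
  sumTo a f + sumTo (suc b) g       ∎
  where
  open ≡-Reasoning
  g : ℕ → ℤ
  g i = f (a ℕ.+ i)

sum-+ : ∀ n (f g : ℕ → ℤ) → sumTo n (λ j → f j + g j) ≡ sumTo n f + sumTo n g
sum-+ ℕ.zero  f g = refl
sum-+ (suc n) f g =
  trans (cong (_+ (f n + g n)) (sum-+ n f g)) (interchange (sumTo n f) (sumTo n g) (f n) (g n))
  where
  interchange : ∀ a b c d → (a + b) + (c + d) ≡ (a + c) + (b + d)
  interchange = ℤSolver.solve-∀

sum-const : ∀ n (c : ℤ) → sumTo n (λ _ → c) ≡ + n * c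
sum-const ℕ.zero  c = sym (ℤP.*-zeroˡ c)
sum-const (suc n) c = trans (cong (_+ c) (sum-const n c)) (one-more (+ n) c)
  where
  one-more : ∀ N c → N * c + c ≡ (+ 1 + N) * c
  one-more = ℤSolver.solve-∀

pair-mono : ∀ {a a′ b b′ : ℤ} → a ≤ a′ → b ≤ b′ → a + b - + 1 ≤ a′ + b′ - + 1
pair-mono a≤a′ b≤b′ = ℤP.+-monoˡ-≤ (- + 1) (ℤP.+-mono-≤ a≤a′ b≤b′)

pred-+ : ∀ a b → (a - + 1) + b ≡ a + b - + 1
pred-+ = ℤSolver.solve-∀

≤-pair : ∀ {a b : ℤ} → + 1 ≤ a → b ≤ a + b - + 1
≤-pair {a} {b} 1≤a = begin
  b              ≡⟨ sym (ℤP.+-identityˡ b) ⟩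
  + 0 + b        ≤⟨ ℤP.+-monoˡ-≤ b (ℤP.i≤j⇒0≤j-i 1≤a) ⟩
  (a - + 1) + b  ≡⟨ pred-+ a b ⟩
  a + b - + 1    ∎
  where open ℤP.≤-Reasoning

-- A prime p ≥ 3 is odd: otherwise 2 would be a proper divisor.
prime-odd : ∀ {p} → Prime p → 3 ℕ.≤ p → p ≡ suc (p / 2 ℕ.* 2)
prime-odd {p} p-prime 3≤p with p % 2 | m≡m%n+[m/n]*n p 2 | m%n<n p 2
... | 0           | p≡2q   | _ = ⊥-elim (Prime.notComposite p-prime (composite 3≤p (divides (p / 2) p≡2q)))
... | 1           | p≡2q+1 | _ = p≡2q+1
... | suc (suc _) | _      | ℕ.s≤s (ℕ.s≤s ())

-- The numerical core of case (IIb): for p = 2q + 1 and 2 ≤ K ≤ q, if K·x + 1 < p + K then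
-- x + K ≤ q + 2.  For x ≤ 2 this is K ≤ q; for x = 3 + a and K = 2 + b the hypothesis
-- reads 2(a + b + 2) + 1 + ab < 2q, so a + b + 3 ≤ q.
short-row : ∀ {q K} x → 2 ℕ.≤ K → K ℕ.≤ q → K ℕ.* x ℕ.+ 1 ℕ.< suc (q ℕ.* 2) ℕ.+ K →
            x ℕ.+ K ℕ.≤ q ℕ.+ 2
short-row {q} {K} x 2≤K K≤q = bound x 2≤K
  where
  at-most-two : ∀ {x} → x ℕ.≤ 2 → x ℕ.+ K ℕ.≤ q ℕ.+ 2
  at-most-two x≤2 = ℕP.≤-trans (ℕP.+-mono-≤ x≤2 K≤q) (ℕP.≤-reflexive (ℕP.+-comm 2 q))

  bound : ∀ x → 2 ℕ.≤ K → K ℕ.* x ℕ.+ 1 ℕ.< suc (q ℕ.* 2) ℕ.+ K → x ℕ.+ K ℕ.≤ q ℕ.+ 2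
  bound 0 _ _ = at-most-two ℕ.z≤n
  bound 1 _ _ = at-most-two (ℕ.s≤s ℕ.z≤n)
  bound 2 _ _ = at-most-two (ℕ.s≤s (ℕ.s≤s ℕ.z≤n))
  bound (suc (suc (suc a))) (ℕ.s≤s (ℕ.s≤s {n = b} _)) short = begin
    3 ℕ.+ a ℕ.+ (2 ℕ.+ b)      ≡⟨ regroup a b ⟩
    suc (a ℕ.+ b ℕ.+ 2) ℕ.+ 2  ≤⟨ ℕP.+-monoˡ-≤ 2 (ℕP.*-cancelˡ-< 2 _ _ doubled) ⟩
    q ℕ.+ 2                    ∎
    where
    open ℕP.≤-Reasoning
    regroup : ∀ a b → 3 ℕ.+ a ℕ.+ (2 ℕ.+ b) ≡ suc (a ℕ.+ b ℕ.+ 2) ℕ.+ 2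
    regroup = ℕSolver.solve-∀
    lhs : ∀ a b → suc ((2 ℕ.+ b) ℕ.* (3 ℕ.+ a) ℕ.+ 1)
                  ≡ (suc (2 ℕ.* (a ℕ.+ b ℕ.+ 2)) ℕ.+ a ℕ.* b) ℕ.+ (3 ℕ.+ b)
    lhs = ℕSolver.solve-∀
    rhs : ∀ q b → suc (q ℕ.* 2) ℕ.+ (2 ℕ.+ b) ≡ 2 ℕ.* q ℕ.+ (3 ℕ.+ b)
    rhs = ℕSolver.solve-∀
    doubled : 2 ℕ.* (a ℕ.+ b ℕ.+ 2) ℕ.< 2 ℕ.* q
    doubled = ℕP.m+n≤o⇒m≤o _ (ℕP.+-cancelʳ-≤ (3 ℕ.+ b) _ _ (subst₂ ℕ._≤_ (lhs a b) (rhs q b) short))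

-- The same for a prime p with 2(K + 1) + 1 ≤ p, stated without q: writing p = 2q + 1
-- (p is odd as p ≥ 7) we have K ≤ q, and 2(x + K) ≤ 2(q + 2) = p + 3.
short-first-row : ∀ {p K x} → Prime p → 2 ℕ.* suc K ℕ.+ 1 ℕ.≤ p → 2 ℕ.≤ K →
                  K ℕ.* x ℕ.+ 1 ℕ.< p ℕ.+ K → 2 ℕ.* (x ℕ.+ K) ℕ.≤ p ℕ.+ 3
short-first-row {p} {K} {x} p-prime 2m+1≤p 2≤K short = begin
  2 ℕ.* (x ℕ.+ K)       ≤⟨ ℕP.*-monoʳ-≤ 2 (short-row x 2≤K K≤q short′) ⟩
  2 ℕ.* (q ℕ.+ 2)       ≡⟨ double q ⟩
  suc (q ℕ.* 2) ℕ.+ 3   ≡⟨ cong (ℕ._+ 3) (sym p-odd) ⟩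
  p ℕ.+ 3               ∎
  where
  open ℕP.≤-Reasoning
  q : ℕ
  q = p / 2
  double : ∀ q → 2 ℕ.* (q ℕ.+ 2) ≡ suc (q ℕ.* 2) ℕ.+ 3
  double = ℕSolver.solve-∀
  2m+1≡ : ∀ K → 2 ℕ.* suc K ℕ.+ 1 ≡ K ℕ.* 2 ℕ.+ 3
  2m+1≡ = ℕSolver.solve-∀
  2K+3≤p : K ℕ.* 2 ℕ.+ 3 ℕ.≤ p
  2K+3≤p = subst (ℕ._≤ p) (2m+1≡ K) 2m+1≤p
  p-odd : p ≡ suc (q ℕ.* 2)
  p-odd = prime-odd p-prime (ℕP.≤-trans (ℕP.m≤n+m 3 (K ℕ.* 2)) 2K+3≤p)
  K≤q : K ℕ.≤ q
  K≤q = subst (ℕ._≤ q) (m*n/n≡m K 2) (/-monoˡ-≤ 2 (ℕP.m+n≤o⇒m≤o (K ℕ.* 2) 2K+3≤p))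
  short′ : K ℕ.* x ℕ.+ 1 ℕ.< suc (q ℕ.* 2) ℕ.+ K
  short′ = subst (λ r → K ℕ.* x ℕ.+ 1 ℕ.< r ℕ.+ K) p-odd short

-- When every pair bound is uncapped, μ_{i+j} ≥ λᵢ + λⱼ - 1, the diagonal pairs (i, i) and
-- the neighbouring pairs (i, i + 1) cover μ₀ … μ_{2i} and give
--   μ₀ + ⋯ + μ_{2i} ≥ 4(λ₀ + ⋯ + λᵢ) - λ₀ - λᵢ - (2i + 1).
staircase : ∀ {m} {lam mu : ℕ → ℤ} →
            (∀ i j → i ℕ.< m → j ℕ.< m → lam i + lam j - + 1 ≤ mu (i ℕ.+ j)) →
            ∀ i → i ℕ.< m →
            + 4 * sumTo (suc i) lam - lam 0 - lam i - (+ 2 * + i + + 1) ≤ sumTo (suc (i ℕ.+ i)) mu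
staircase {lam = lam} {mu} pair-bound ℕ.zero 0<m = begin
  + 4 * (+ 0 + lam 0) - lam 0 - lam 0 - (+ 2 * + 0 + + 1)  ≡⟨ base (lam 0) ⟩
  lam 0 + lam 0 - + 1                                      ≤⟨ pair-bound 0 0 0<m 0<m ⟩
  mu 0                                                     ≡⟨ sym (ℤP.+-identityˡ (mu 0)) ⟩
  + 0 + mu 0                                               ∎
  where
  open ℤP.≤-Reasoning
  base : ∀ l → + 4 * (+ 0 + l) - l - l - (+ 2 * + 0 + + 1) ≡ l + l - + 1
  base = ℤSolver.solve-∀
staircase {m} {lam} {mu} pair-bound (suc i) 1+i<m = begin
  + 4 * (Λ + lam (suc i)) - lam 0 - lam (suc i) - (+ 2 * (+ 1 + + i) + + 1)
    ≡⟨ step Λ (lam 0) (lam i) (lam (suc i)) (+ i) ⟩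
  (+ 4 * Λ - lam 0 - lam i - (+ 2 * + i + + 1)) + (lam i + lam (suc i) - + 1)
    + (lam (suc i) + lam (suc i) - + 1)
    ≤⟨ ℤP.+-mono-≤ (ℤP.+-mono-≤ (staircase pair-bound i i<m) (pair-bound i (suc i) i<m 1+i<m))
                   (pair-bound (suc i) (suc i) 1+i<m 1+i<m) ⟩
  sumTo (suc (i ℕ.+ i)) mu + mu (i ℕ.+ suc i) + mu (suc i ℕ.+ suc i)
    ≡⟨ cong (λ k → sumTo k mu + mu (i ℕ.+ suc i) + mu (suc i ℕ.+ suc i)) (sym (ℕP.+-suc i i)) ⟩
  sumTo (suc (suc i ℕ.+ suc i)) mu
    ∎
  where
  open ℤP.≤-Reasoning
  Λ : ℤ
  Λ = sumTo (suc i) lam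
  i<m : i ℕ.< m
  i<m = ℕP.<-trans (ℕP.n<1+n i) 1+i<m
  step : ∀ Λ l₀ lᵢ l′ I →
         + 4 * (Λ + l′) - l₀ - l′ - (+ 2 * (+ 1 + I) + + 1)
         ≡ (+ 4 * Λ - l₀ - lᵢ - (+ 2 * I + + 1)) + (lᵢ + l′ - + 1) + (l′ + l′ - + 1)
  step = ℤSolver.solve-∀

odd-multiple : ∀ n (P : ℤ) → + (2 ℕ.* n ℕ.+ 1) * P ≡ (+ n * P + + n * P) + P
odd-multiple n P = trans (cong (λ c → (c + + 1) * P) (ℤP.pos-* 2 n)) (expand (+ n) P)
  where
  expand : ∀ N P → (+ 2 * N + + 1) * P ≡ (N * P + N * P) + P
  expand = ℤSolver.solve-∀

saturated-case : ∀ {n p K} {l₀ T H C : ℤ} → n ℕ.+ 1 ℕ.≤ K → + n * + p + + 1 ≤ l₀ + T →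
                 + K * + p + l₀ ≤ H → T ≤ C → + (2 ℕ.* n ℕ.+ 1) * + p ≤ H + C
saturated-case {n} {p} {K} {l₀} {T} {H} {C} n+1≤K sum≥ head≥ tail≥ = begin
  + (2 ℕ.* n ℕ.+ 1) * + p          ≡⟨ odd-multiple n (+ p) ⟩
  (+ n * + p + + n * + p) + + p    ≡⟨ regroup (+ n) (+ p) ⟩
  (+ n + + 1) * + p + + n * + p    ≤⟨ ℤP.+-mono-≤ (ℤP.*-monoʳ-≤-nonNeg (+ p) (+≤+ n+1≤K))
                                                  (ℤP.≤-trans (ℤP.i≤i+j _ (+ 1)) sum≥) ⟩
  + K * + p + (l₀ + T)             ≡⟨ sym (ℤP.+-assoc (+ K * + p) l₀ T) ⟩
  + K * + p + l₀ + T               ≤⟨ ℤP.+-mono-≤ head≥ tail≥ ⟩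
  H + C                            ∎
  where
  open ℤP.≤-Reasoning
  regroup : ∀ N P → (N * P + N * P) + P ≡ (N + + 1) * P + N * P
  regroup = ℤSolver.solve-∀

-- Cases (Ib) and (IIa): a head of at least p + 2(λ₀ - 1) + T and a tail of at least T
-- give p + 2S - 2 ≥ p + 2np.
balanced-case : ∀ {n p} {l₀ T H C : ℤ} → + n * + p + + 1 ≤ l₀ + T →
                + p + (l₀ + l₀ - + 2) + T ≤ H → T ≤ C → + (2 ℕ.* n ℕ.+ 1) * + p ≤ H + C
balanced-case {n} {p} {l₀} {T} {H} {C} sum≥ head≥ tail≥ = begin
  + (2 ℕ.* n ℕ.+ 1) * + p                        ≡⟨ odd-multiple n (+ p) ⟩
  (+ n * + p + + n * + p) + + p                  ≡⟨ regroup (+ n * + p) (+ p) ⟩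
  + p + ((+ n * + p + + 1) + (+ n * + p + + 1) - + 2)
    ≤⟨ ℤP.+-monoʳ-≤ (+ p) (ℤP.+-monoˡ-≤ (- + 2) (ℤP.+-mono-≤ sum≥ sum≥)) ⟩
  + p + ((l₀ + T) + (l₀ + T) - + 2)              ≡⟨ regroup′ (+ p) l₀ T ⟩
  + p + (l₀ + l₀ - + 2) + T + T                  ≤⟨ ℤP.+-mono-≤ head≥ tail≥ ⟩
  H + C                                          ∎
  where
  open ℤP.≤-Reasoning
  regroup : ∀ X P → (X + X) + P ≡ P + ((X + + 1) + (X + + 1) - + 2)
  regroup = ℤSolver.solve-∀
  regroup′ : ∀ P l T → P + ((l + T) + (l + T) - + 2) ≡ P + (l + l - + 2) + T + T
  regroup′ = ℤSolver.solve-∀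

-- Case (IIb): the staircase bound 4S - λ₀ - λ_K - (2K + 1) with a short first row,
-- 2(λ₀ + K) ≤ p + 3, is at least 4(np + 1) - (p + 4) ≥ (2n + 1)p since n ≥ 1.
staircase-case : ∀ {n p K} {S l₀ lₖ X : ℤ} → 1 ℕ.≤ n → + n * + p + + 1 ≤ S →
                 + 2 * (l₀ + + K) ≤ + p + + 3 → lₖ ≤ l₀ →
                 + 4 * S - l₀ - lₖ - (+ 2 * + K + + 1) ≤ X → + (2 ℕ.* n ℕ.+ 1) * + p ≤ X
staircase-case {n} {p} {K} {S} {l₀} {lₖ} {X} 1≤n sum≥ short lₖ≤l₀ stairs = begin
  + (2 ℕ.* n ℕ.+ 1) * P                     ≡⟨ odd-multiple n P ⟩
  (nP + nP) + P                             ≡⟨ borrow nP P ⟩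
  (nP + nP) + (P + P) - P
    ≤⟨ ℤP.+-monoˡ-≤ (- P) (ℤP.+-monoʳ-≤ (nP + nP) (ℤP.+-mono-≤ P≤nP P≤nP)) ⟩
  (nP + nP) + (nP + nP) - P                 ≡⟨ quadruple nP P ⟩
  + 4 * (nP + + 1) - (P + + 4)
    ≤⟨ ℤP.+-monoˡ-≤ (- (P + + 4)) (ℤP.*-monoˡ-≤-nonNeg (+ 4) sum≥) ⟩
  + 4 * S - (P + + 4)                       ≤⟨ ℤP.+-monoʳ-≤ (+ 4 * S) (ℤP.neg-mono-≤ corners) ⟩
  + 4 * S - (l₀ + lₖ + (+ 2 * + K + + 1))   ≡⟨ spread (+ 4 * S) l₀ lₖ (+ 2 * + K + + 1) ⟩
  + 4 * S - l₀ - lₖ - (+ 2 * + K + + 1)     ≤⟨ stairs ⟩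
  X                                         ∎
  where
  open ℤP.≤-Reasoning
  P nP : ℤ
  P = + p
  nP = + n * P
  P≤nP : P ≤ nP
  P≤nP = subst (_≤ nP) (ℤP.*-identityˡ P) (ℤP.*-monoʳ-≤-nonNeg P (+≤+ 1≤n))
  borrow : ∀ Y P → (Y + Y) + P ≡ (Y + Y) + (P + P) - P
  borrow = ℤSolver.solve-∀
  quadruple : ∀ Y P → (Y + Y) + (Y + Y) - P ≡ + 4 * (Y + + 1) - (P + + 4)
  quadruple = ℤSolver.solve-∀
  spread : ∀ A a b c → A - (a + b + c) ≡ A - a - b - c
  spread = ℤSolver.solve-∀
  twice : ∀ l k → l + l + (+ 2 * k + + 1) ≡ + 2 * (l + k) + + 1
  twice = ℤSolver.solve-∀
  corners : l₀ + lₖ + (+ 2 * + K + + 1) ≤ P + + 4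
  corners = begin
    l₀ + lₖ + (+ 2 * + K + + 1)   ≤⟨ ℤP.+-monoˡ-≤ (+ 2 * + K + + 1) (ℤP.+-monoʳ-≤ l₀ lₖ≤l₀) ⟩
    l₀ + l₀ + (+ 2 * + K + + 1)   ≡⟨ twice l₀ (+ K) ⟩
    + 2 * (l₀ + + K) + + 1        ≤⟨ ℤP.+-monoˡ-≤ (+ 1) short ⟩
    P + + 3 + + 1                 ≡⟨ ℤP.+-assoc P (+ 3) (+ 1) ⟩
    P + + 4                       ∎

module Setting (p K : ℕ) (lam mu : ℕ → ℤ)
  (lam≤p    : ∀ k → k ℕ.< suc K → lam k ≤ + p)
  (lam-step : ∀ k → suc k ℕ.< suc K → lam (suc k) ≤ lam k)
  (lam-pos  : ∀ k → k ℕ.< suc K → + 0 < lam k)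
  (mu≥      : ∀ i j → i ℕ.< suc K → j ℕ.< suc K → mu (i ℕ.+ j) ≥ ((lam i + lam j - + 1) ⊓ + p))
  where

  T : ℤ
  T = sumTo K (λ i → lam (suc i))

  head tail : ℤ
  head = sumTo (suc K) mu
  tail = sumTo K (λ i → mu (suc K ℕ.+ i))

  head+tail : head + tail ≡ sumTo (suc (K ℕ.+ K)) mu
  head+tail = sym (sum-split (suc K) K mu)

  lam≥1 : ∀ {j} → j ℕ.< suc K → + 1 ≤ lam j
  lam≥1 j<m = ℤP.i<j⇒suc[i]≤j (lam-pos _ j<m)

  lam-antitone : ∀ {i j} → i ℕ.≤ j → j ℕ.< suc K → lam j ≤ lam i
  lam-antitone i≤j = go (ℕP.≤⇒≤′ i≤j)
    where
    go : ∀ {i j} → i ℕ.≤′ j → j ℕ.< suc K → lam j ≤ lam i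
    go ℕ.≤′-refl             _     = ℤP.≤-refl
    go (ℕ.≤′-step {j} i≤′j) 1+j<m =
      ℤP.≤-trans (lam-step j 1+j<m) (go i≤′j (ℕP.<-trans (ℕP.n<1+n j) 1+j<m))

  mu-capped : ∀ {i j} → i ℕ.< suc K → j ℕ.< suc K → + p ≤ lam i + lam j - + 1 →
              + p ≤ mu (i ℕ.+ j)
  mu-capped i<m j<m cap = ℤP.≤-trans (ℤP.≤-reflexive (sym (ℤP.i≥j⇒i⊓j≡j cap))) (mu≥ _ _ i<m j<m)

  mu-uncapped : ∀ {i j} → i ℕ.< suc K → j ℕ.< suc K → lam i + lam j - + 1 ≤ + p →
                lam i + lam j - + 1 ≤ mu (i ℕ.+ j)
  mu-uncapped i<m j<m uncap =
    ℤP.≤-trans (ℤP.≤-reflexive (sym (ℤP.i≤j⇒i⊓j≡i uncap))) (mu≥ _ _ i<m j<m)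

  -- In any case μ_{i+j} ≥ λⱼ, as λᵢ ≥ 1 and λⱼ ≤ p.
  mu≥lam : ∀ {i j} → i ℕ.< suc K → j ℕ.< suc K → lam j ≤ mu (i ℕ.+ j)
  mu≥lam i<m j<m = ℤP.≤-trans (ℤP.⊓-glb (≤-pair (lam≥1 i<m)) (lam≤p _ j<m)) (mu≥ _ _ i<m j<m)

  mu-uncapped-everywhere : ¬ (+ p ≤ lam 0 + lam 0 - + 1) →
                           ∀ i j → i ℕ.< suc K → j ℕ.< suc K → lam i + lam j - + 1 ≤ mu (i ℕ.+ j)
  mu-uncapped-everywhere small i j i<m j<m = mu-uncapped i<m j<m
    (ℤP.≤-trans (pair-mono (lam-antitone ℕ.z≤n i<m) (lam-antitone ℕ.z≤n j<m)) (ℤP.<⇒≤ (ℤP.≰⇒> small)))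

  -- The tail: μ_{m+i} = μ_{K+(i+1)} ≥ λ_{i+1}.
  tail-bound : T ≤ tail
  tail-bound = sum-mono K λ i i<K →
    subst (λ k → lam (suc i) ≤ mu k) (ℕP.+-suc K i) (mu≥lam (ℕP.n<1+n K) (ℕ.s≤s i<K))

  -- Case (Ia): if λ₀ + λ_{K-1} - 1 ≥ p, then μ₀, …, μ_{K-1} ≥ p and μ_K ≥ λ₀.
  saturated-head : 2 ℕ.≤ K → + p ≤ lam 0 + lam (K ℕ.∸ 1) - + 1 → + K * + p + lam 0 ≤ head
  saturated-head (ℕ.s≤s (ℕ.s≤s _)) cap = ℤP.+-mono-≤ capped-prefix last
    where
    K-1<m : K ℕ.∸ 1 ℕ.< suc K
    K-1<m = ℕP.m<n⇒m<1+n (ℕP.n<1+n _)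
    capped-prefix : + K * + p ≤ sumTo K mu
    capped-prefix = subst (_≤ sumTo K mu) (sum-const K (+ p)) (sum-mono K λ j j<K →
      mu-capped {0} ℕ.z<s (ℕP.m<n⇒m<1+n j<K)
        (ℤP.≤-trans cap (pair-mono (ℤP.≤-refl {lam 0}) (lam-antitone (ℕP.≤-pred j<K) K-1<m))))
    last : lam 0 ≤ mu K
    last = subst (λ k → lam 0 ≤ mu k) (ℕP.+-identityʳ K) (mu≥lam (ℕP.n<1+n K) ℕ.z<s)

  -- Case (Ib): if 2λ₀ - 1 ≥ p > λ₀ + λ_{K-1} - 1, then μ₀ ≥ p, μⱼ ≥ λⱼ for 0 < j < K - 1,
  -- and the last two head entries are uncapped: μⱼ ≥ λ₀ + λⱼ - 1 for j = K - 1, K.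
  partly-capped-head : 2 ℕ.≤ K → + p ≤ lam 0 + lam 0 - + 1 →
                       ¬ (+ p ≤ lam 0 + lam (K ℕ.∸ 1) - + 1) → + p + (lam 0 + lam 0 - + 2) + T ≤ head
  partly-capped-head (ℕ.s≤s (ℕ.s≤s {n = k} _)) corner end = begin
    + p + (lam 0 + lam 0 - + 2) + (A + lam (suc k) + lam (suc (suc k)))
      ≡⟨ regroup (+ p) (lam 0) A (lam (suc k)) (lam (suc (suc k))) ⟩
    + p + A + (lam 0 + lam (suc k) - + 1) + (lam 0 + lam (suc (suc k)) - + 1)
      ≤⟨ ℤP.+-mono-≤ (ℤP.+-mono-≤ (ℤP.+-mono-≤ μ₀≥p middle) (mu-uncapped ℕ.z<s K-1<m below)) last ⟩
    mu 0 + sumTo k (λ j → mu (suc j)) + mu (suc k) + mu (suc (suc k))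
      ≡⟨ cong (λ s → s + mu (suc k) + mu (suc (suc k))) (sym (sum-shift k mu)) ⟩
    head
      ∎
    where
    open ℤP.≤-Reasoning
    A : ℤ
    A = sumTo k (λ j → lam (suc j))
    K-1<m : suc k ℕ.< suc (suc (suc k))
    K-1<m = ℕP.m<n⇒m<1+n (ℕP.n<1+n (suc k))
    below : lam 0 + lam (suc k) - + 1 ≤ + p
    below = ℤP.<⇒≤ (ℤP.≰⇒> end)
    last : lam 0 + lam (suc (suc k)) - + 1 ≤ mu (suc (suc k))
    last = mu-uncapped ℕ.z<s (ℕP.n<1+n _)
             (ℤP.≤-trans (pair-mono (ℤP.≤-refl {lam 0}) (lam-step (suc k) (ℕP.n<1+n _))) below)
    μ₀≥p : + p ≤ mu 0
    μ₀≥p = mu-capped ℕ.z<s ℕ.z<s corner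
    middle : A ≤ sumTo k (λ j → mu (suc j))
    middle = sum-mono k λ j j<k → mu≥lam ℕ.z<s (ℕ.s≤s (ℕP.m≤n⇒m≤1+n (ℕP.m≤n⇒m≤1+n j<k)))
    regroup : ∀ P l A a b → P + (l + l - + 2) + (A + a + b) ≡ P + A + (l + a - + 1) + (l + b - + 1)
    regroup = ℤSolver.solve-∀

  -- Case (IIa): if no bound is capped and K(λ₀ - 1) ≥ p - 1, row 0 alone gives
  -- head ≥ Σⱼ (λ₀ - 1 + λⱼ) = m(λ₀ - 1) + λ₀ + T ≥ p + 2(λ₀ - 1) + T.
  uncapped-head : ¬ (+ p ≤ lam 0 + lam 0 - + 1) → + p + + K ≤ + K * lam 0 + + 1 →
                  + p + (lam 0 + lam 0 - + 2) + T ≤ head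
  uncapped-head small long = begin
    + p + (lam 0 + lam 0 - + 2) + T
      ≡⟨ borrow (+ p) (+ K) (lam 0) T ⟩
    (+ p + + K) + rest
      ≤⟨ ℤP.+-monoˡ-≤ rest long ⟩
    (+ K * lam 0 + + 1) + rest
      ≡⟨ collect (+ K) (lam 0) T ⟩
    (+ 1 + + K) * (lam 0 - + 1) + (lam 0 + T)
      ≡⟨ cong (λ s → (+ 1 + + K) * (lam 0 - + 1) + s) (sym (sum-shift K lam)) ⟩
    + (suc K) * (lam 0 - + 1) + sumTo (suc K) lam
      ≡⟨ cong (_+ sumTo (suc K) lam) (sym (sum-const (suc K) (lam 0 - + 1))) ⟩
    sumTo (suc K) (λ _ → lam 0 - + 1) + sumTo (suc K) lam
      ≡⟨ sym (sum-+ (suc K) (λ _ → lam 0 - + 1) lam) ⟩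
    sumTo (suc K) (λ j → (lam 0 - + 1) + lam j)
      ≤⟨ sum-mono (suc K) row-0 ⟩
    head
      ∎
    where
    open ℤP.≤-Reasoning
    rest : ℤ
    rest = lam 0 + lam 0 - + 2 + T - + K
    row-0 : ∀ j → j ℕ.< suc K → (lam 0 - + 1) + lam j ≤ mu j
    row-0 j j<m =
      subst (_≤ mu j) (sym (pred-+ (lam 0) (lam j))) (mu-uncapped-everywhere small 0 j ℕ.z<s j<m)
    borrow : ∀ P K l T → P + (l + l - + 2) + T ≡ (P + K) + (l + l - + 2 + T - K)
    borrow = ℤSolver.solve-∀
    collect : ∀ K l T → (K * l + + 1) + (l + l - + 2 + T - K) ≡ (+ 1 + K) * (l - + 1) + (l + T)
    collect = ℤSolver.solve-∀

  short-lam₀ : Prime p → 2 ℕ.* suc K ℕ.+ 1 ℕ.≤ p → 2 ℕ.≤ K →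
               ¬ (+ p + + K ≤ + K * lam 0 + + 1) → + 2 * (lam 0 + + K) ≤ + p + + 3
  short-lam₀ p-prime 2m+1≤p 2≤K short =
    subst (_≤ + p + + 3) (trans (ℤP.pos-* 2 (x ℕ.+ K)) (cong (λ l → + 2 * (l + + K)) x≡λ₀))
          (+≤+ (short-first-row p-prime 2m+1≤p 2≤K short-ℕ))
    where
    x : ℕ
    x = ∣ lam 0 ∣
    x≡λ₀ : + x ≡ lam 0
    x≡λ₀ = ℤP.0≤i⇒+∣i∣≡i (ℤP.<⇒≤ (lam-pos 0 ℕ.z<s))
    short-ℕ : K ℕ.* x ℕ.+ 1 ℕ.< p ℕ.+ K
    short-ℕ = ℤP.drop‿+<+ (subst (λ y → y + + 1 < + p + + K)
                (trans (cong (+ K *_) (sym x≡λ₀)) (sym (ℤP.pos-* K x))) (ℤP.≰⇒> short))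

two-m-minus-one : ∀ K → 2 ℕ.* suc K ℕ.∸ 1 ≡ suc (K ℕ.+ K)
two-m-minus-one K = trans (ℕP.+-suc K (K ℕ.+ 0)) (cong (λ k → suc (K ℕ.+ k)) (ℕP.+-identityʳ K))

lemma6p2 : (p m n : ℕ) → Prime p → 1 ℕ.≤ n → n ℕ.+ 2 ℕ.≤ m → 2 ℕ.* m ℕ.+ 1 ℕ.≤ p →
    (lam : ℕ → ℤ) → (mu : ℕ → ℤ) →
    (∀ k → k ℕ.< m → lam k ≤ + p) →
    (∀ k → suc k ℕ.< m → lam (suc k) ≤ lam k) →
    (∀ k → k ℕ.< m → + 0 < lam k) →
    + n * + p + + 1 ≤ sumTo m lam →
    (∀ i j → i ℕ.< m → j ℕ.< m → mu (i ℕ.+ j) ≥ ((lam i + lam j - + 1) ⊓ + p)) →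
    sumTo (2 ℕ.* m ℕ.∸ 1) mu ≥ + (2 ℕ.* n ℕ.+ 1) * + p
lemma6p2 p ℕ.zero n _ 1≤n n+2≤m _ _ _ _ _ _ _ _ with ℕP.≤-trans (ℕP.+-monoˡ-≤ 2 1≤n) n+2≤m
... | ()
lemma6p2 p (suc K) n p-prime 1≤n n+2≤m 2m+1≤p lam mu lam≤p lam-step lam-pos sum≥ mu≥ =
  subst (λ k → sumTo k mu ≥ + (2 ℕ.* n ℕ.+ 1) * + p) (sym (two-m-minus-one K))
    (by-cases (+ p ℤP.≤? lam 0 + lam 0 - + 1) (+ p ℤP.≤? lam 0 + lam (K ℕ.∸ 1) - + 1)
              (+ p + + K ℤP.≤? + K * lam 0 + + 1))
  where
  open Setting p K lam mu lam≤p lam-step lam-pos mu≥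
  2≤K : 2 ℕ.≤ K
  2≤K = ℕP.≤-pred (ℕP.≤-trans (ℕP.+-monoˡ-≤ 2 1≤n) n+2≤m)
  n+1≤K : n ℕ.+ 1 ℕ.≤ K
  n+1≤K = ℕP.≤-pred (subst (ℕ._≤ suc K) (ℕP.+-suc n 1) n+2≤m)
  sum≥′ : + n * + p + + 1 ≤ lam 0 + T
  sum≥′ = subst (+ n * + p + + 1 ≤_) (sum-shift K lam) sum≥
  via-head : ∀ {X} → X ≤ head + tail → X ≤ sumTo (suc (K ℕ.+ K)) mu
  via-head X≤ = ℤP.≤-trans X≤ (ℤP.≤-reflexive head+tail)
  by-cases : Dec (+ p ≤ lam 0 + lam 0 - + 1) → Dec (+ p ≤ lam 0 + lam (K ℕ.∸ 1) - + 1) →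
             Dec (+ p + + K ≤ + K * lam 0 + + 1) →
             + (2 ℕ.* n ℕ.+ 1) * + p ≤ sumTo (suc (K ℕ.+ K)) mu
  by-cases (yes _)      (yes cap) _          =
    via-head (saturated-case n+1≤K sum≥′ (saturated-head 2≤K cap) tail-bound)
  by-cases (yes corner) (no end)  _          =
    via-head (balanced-case {n} {p} {lam 0} sum≥′ (partly-capped-head 2≤K corner end) tail-bound)
  by-cases (no small)   _         (yes long) =
    via-head (balanced-case {n} {p} {lam 0} sum≥′ (uncapped-head small long) tail-bound)
  by-cases (no small)   _         (no short) =
    staircase-case 1≤n sum≥ (short-lam₀ p-prime 2m+1≤p 2≤K short)
      (lam-antitone ℕ.z≤n (ℕP.n<1+n K)) (staircase (mu-uncapped-everywhere small) K (ℕP.n<1+n K))
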